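{- Let $(G,d,k)$ be an instance of Planar Vector Dominating Set that is reduced with respect to Rules (R1)–(R5) below, and let $S$ be a solution (a vector dominating set with $|S|\le k$). Let $A$ be the set of $0$-vertices $u$ such that every neighbor of $u$ has at least two neighbors in $S$, and let $L$ be the set of all leeches of real paths. Then every vertex $v\in V(G)\setminus(S\cup A\cup L)$ belongs to some real path.
   Context: $G=(V,E)$ is a planar graph, $d:V\to\mathbb{N}$ a demand function, $k\ge0$ an integer. A vector dominating set (solution) is a set $S\subseteq V$, $|S|\le k$, such that every $v\in V\setminus S$ has at least $d(v)$ neighbors in $S$. A $j$-vertex is a vertex $v$ with $d(v)=j$; $v$ is high-demand if $d(v)>0$. $N(v)$ is the neighborhood, $N[v]=N(v)\cup\{v\}$, and $N_h[v]$ is the set of high-demand vertices of $N[v]$. The instance is reduced with respect to: (R1) no two $0$-vertices are adjacent; (R2) there is no isolated $0$-vertex; (R3) every vertex $v$ satisfies $d(v)\le k$ and $d(v)\le |N(v)|$; (R4) for every $0$-vertex $v$ and every vertex $a\neq v$ with $N(v)\subseteq N[a]$, $v$ is not adjacent to $a$ and $v$ has no neighbor that is a $1$-vertex; (R5) there is no $1$-vertex $v$ having a neighbor $a$ such that every $u\in N[v]\setminus\{a\}$ satisfies $d(u)\le1$ and $N_h[u]\subseteq N[a]$. For distinct $s_1,s_2\in V$: a type 1 path is an $s_1s_2$-path of length 2; a type 2 path is an $s_1s_2$-path $s_1\,v\,c\,v'\,s_2$ of length 4 with $d(c)=0$, $d(v)=1$, $v\notin N(s_2)$, $v'\notin N(s_1)$;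 a type 3 path is an $s_1s_2$-path $s_1\,v\,v'\,s_2$ of length 3 with $d(v)\le1$, and a leech of such a path is a $1$-vertex not on the path adjacent to both $s_1$ and $v$. Given the solution $S$, a real path is a path with both endpoints in $S$ which is either a type 1 path, or a type 2 path $s_1vcv's_2$ such that $v$ and $v'$ are not both used by type 1 real paths, or a type 3 path $s_1vv's_2$ such that $v$ and $v'$ are not both used by type 1 real paths. -}

module Defs where

open import Data.Nat using (ℕ; zero; suc; _≤_; _<_; _<ᵇ_; _≡ᵇ_)
open import Data.Bool using (Bool; true; false; not; _xor_)
open import Data.Fin using (Fin; toℕ)
open import Data.Fin.Subset using (Subset; _∈_; _∉_; _⊆_; _∪_; _∩_; ⁅_⁆; ∣_∣)
open import Data.Vec using (tabulate)
open import Data.List using (List; []; _∷_)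
open import Data.List.Membership.Propositional using () renaming (_∈_ to _∈ₗ_)
open import Data.List.Relation.Unary.Unique.Propositional using (Unique)
open import Data.Product using (Σ; ∃; ∃-syntax; _×_; _,_)
open import Data.Sum using (_⊎_)
open import Data.Empty using (⊥)
open import Relation.Nullary using (¬_)
open import Relation.Binary.PropositionalEquality using (_≡_; _≢_)

record Graph (n : ℕ) : Set where
  field
    E      : Fin n → Fin n → Bool
    sym    : ∀ u v → E u v ≡ E v u
    irrefl : ∀ v → E v v ≡ false
open Graph public

module _ {n : ℕ} (G : Graph n) where

  Adj : Fin n → Fin n → Set
  Adj u v = E G u v ≡ true

  N : Fin n → Subset n
  N v = tabulate (λ u → E G v u)

  N[_] : Fin n → Subset n
  N[ v ] = N v ∪ ⁅ v ⁆

  -- Planarity (via Wagner's theorem: no K5 and no K3,3 minor).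

  data WalkIn (B : Subset n) : Fin n → Fin n → Set where
    here : ∀ {x} → x ∈ B → WalkIn B x x
    step : ∀ {x z y} → x ∈ B → Adj x z → WalkIn B z y → WalkIn B x y

  record MinorModel {m : ℕ} (EH : Fin m → Fin m → Bool) : Set where
    field
      branch    : Fin m → Subset n
      nonempty  : ∀ i → ∃[ x ] (x ∈ branch i)
      disjoint  : ∀ i j → i ≢ j → ∀ x → x ∈ branch i → x ∈ branch j → ⊥
      connected : ∀ i x y → x ∈ branch i → y ∈ branch i → WalkIn (branch i) x y
      edges     : ∀ i j → EH i j ≡ true →
                  ∃[ x ] ∃[ y ] (x ∈ branch i × y ∈ branch j × Adj x y)

K5-edges : Fin 5 → Fin 5 → Bool
K5-edges i j = not (toℕ i ≡ᵇ toℕ j)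

K33-edges : Fin 6 → Fin 6 → Bool
K33-edges i j = (toℕ i <ᵇ 3) xor (toℕ j <ᵇ 3)

Planar : ∀ {n} → Graph n → Set
Planar G = ¬ MinorModel G K5-edges × ¬ MinorModel G K33-edges

module _ {n : ℕ} (G : Graph n) (d : Fin n → ℕ) where

  degIn : Subset n → Fin n → ℕ
  degIn S v = ∣ N G v ∩ S ∣

  Solution : ℕ → Subset n → Set
  Solution k S = ∣ S ∣ ≤ k × (∀ v → v ∉ S → d v ≤ degIn S v)

  NhSubset : Fin n → Subset n → Set
  NhSubset u X = ∀ w → w ∈ N[_] G u → 0 < d w → w ∈ X

  R1 R2 R4 R5 : Set
  R1 = ∀ u v → Adj G u v → d u ≡ 0 → d v ≡ 0 → ⊥
  R2 = ∀ v → d v ≡ 0 → ∃[ u ] Adj G v u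
  R4 = ∀ v a → d v ≡ 0 → a ≢ v → N G v ⊆ N[_] G a →
         (¬ Adj G v a) × (∀ w → Adj G v w → d w ≢ 1)
  R5 = ∀ v a → d v ≡ 1 → Adj G v a →
         ¬ (∀ u → u ∈ N[_] G v → u ≢ a → d u ≤ 1 × NhSubset u (N[_] G a))

  R3 : ℕ → Set
  R3 k = ∀ v → d v ≤ k × d v ≤ ∣ N G v ∣

  Reduced : ℕ → Set
  Reduced k = R1 × R2 × R3 k × R4 × R5

  data Consecutive : List (Fin n) → Set where
    nil  : Consecutive []
    one  : ∀ x → Consecutive (x ∷ [])
    cons : ∀ {x y p} → Adj G x y → Consecutive (y ∷ p) → Consecutive (x ∷ y ∷ p)

  IsPath : List (Fin n) → Set
  IsPath p = Consecutive p × Unique p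

  Type1 : Fin n → Fin n → List (Fin n) → Set
  Type1 s1 s2 P = s1 ≢ s2 × Σ (Fin n) λ v → P ≡ s1 ∷ v ∷ s2 ∷ [] × IsPath P

  Type2 : Fin n → Fin n → List (Fin n) → Set
  Type2 s1 s2 P = s1 ≢ s2 × Σ (Fin n) λ v → Σ (Fin n) λ c → Σ (Fin n) λ v' →
    P ≡ s1 ∷ v ∷ c ∷ v' ∷ s2 ∷ [] × IsPath P ×
    d c ≡ 0 × d v ≡ 1 × ¬ Adj G v s2 × ¬ Adj G v' s1

  Type3 : Fin n → Fin n → List (Fin n) → Set
  Type3 s1 s2 P = s1 ≢ s2 × Σ (Fin n) λ v → Σ (Fin n) λ v' →
    P ≡ s1 ∷ v ∷ v' ∷ s2 ∷ [] × IsPath P × d v ≤ 1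

  Leech : Fin n → Fin n → Fin n → Fin n → Fin n → Set
  Leech s1 v v' s2 ℓ = d ℓ ≡ 1 × ¬ (ℓ ∈ₗ s1 ∷ v ∷ v' ∷ s2 ∷ []) × Adj G ℓ s1 × Adj G ℓ v

  module _ (S : Subset n) where

    RealType1 : List (Fin n) → Set
    RealType1 P = Σ (Fin n) λ s1 → Σ (Fin n) λ s2 → s1 ∈ S × s2 ∈ S × Type1 s1 s2 P

    UsedByType1 : Fin n → Set
    UsedByType1 x = Σ (List (Fin n)) λ P → RealType1 P × x ∈ₗ P

    RealType2 : List (Fin n) → Set
    RealType2 P = Σ (Fin n) λ s1 → Σ (Fin n) λ s2 → s1 ∈ S × s2 ∈ S ×
      Σ (Fin n) λ v → Σ (Fin n) λ c → Σ (Fin n) λ v' →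
        P ≡ s1 ∷ v ∷ c ∷ v' ∷ s2 ∷ [] × Type2 s1 s2 P ×
        ¬ (UsedByType1 v × UsedByType1 v')

    RealType3 : Fin n → Fin n → Fin n → Fin n → Set
    RealType3 s1 v v' s2 = s1 ∈ S × s2 ∈ S × Type3 s1 s2 (s1 ∷ v ∷ v' ∷ s2 ∷ []) ×
      ¬ (UsedByType1 v × UsedByType1 v')

    RealPath : List (Fin n) → Set
    RealPath P = RealType1 P ⊎ RealType2 P ⊎
      (Σ (Fin n) λ s1 → Σ (Fin n) λ v → Σ (Fin n) λ v' → Σ (Fin n) λ s2 →
         P ≡ s1 ∷ v ∷ v' ∷ s2 ∷ [] × RealType3 s1 v v' s2)

    InA : Fin n → Set
    InA u = d u ≡ 0 × (∀ w → Adj G u w → 2 ≤ degIn S w)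

    InL : Fin n → Set
    InL ℓ = Σ (Fin n) λ s1 → Σ (Fin n) λ v → Σ (Fin n) λ v' → Σ (Fin n) λ s2 →
      RealType3 s1 v v' s2 × Leech s1 v v' s2 ℓ

    OnRealPath : Fin n → Set
    OnRealPath x = Σ (List (Fin n)) λ P → RealPath P × x ∈ₗ P

{-# OPTIONS --safe #-}
module Submission where

-- A vertex outside S with at most one S-neighbour has demand ≤ 1 and lies on no type 1 real
-- path, so every type 2 or 3 path whose first inner vertex is such a vertex is real.
-- If v ∉ S has two S-neighbours it is the middle of a type 1 path; otherwise d v ∈ {0, 1}.
-- For d v = 0, rule (R4) yields a neighbour x of v outside N[s₁], where s₁ is the S-neighbour
-- of v, or (if there is none) the S-neighbour of a 1-neighbour w of v, which exists as v ∉ A;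
-- x has an S-neighbour s₂ ≠ s₁, giving the path s₁ v x s₂ or s₁ w v x s₂.
-- For d v = 1 with S-neighbour s₁, either a neighbour of v sees some s₂ ≠ s₁ in S, or (R5)
-- provides a walk v u w with w a high-demand vertex outside N[s₁]; then s₁ v u w s₂ is a type 2
-- path if d u = 0, and if d u = 1 then s₁ u w s₂ is a real type 3 path with leech v.

open import Defs hiding (sym)
open import Data.Nat using (ℕ; _≤_; _<_; z≤n; s≤s; _≤?_; _<?_)
open import Data.Nat.Properties
  using (≤-trans; ≤-reflexive; ≤-antisym; <⇒≱; ≰⇒>; n≢0⇒n>0; n>0⇒n≢0; n≤1⇒n≡0∨n≡1)
open import Data.Bool using (true)
open import Data.Bool.Properties using () renaming (_≟_ to _≟ᵇ_)
open import Data.Fin using (Fin; _≟_)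
open import Data.Fin.Properties using (any?; ¬∀⟶∃¬)
open import Data.Fin.Subset using (Subset; _∈_; _∉_; _⊆_; _⊈_; _∩_; ⁅_⁆; ∣_∣; Nonempty; Empty)
open import Data.Fin.Subset.Properties
  using ( _∈?_; nonempty?; Empty-unique; ∣⊥∣≡0; x∈⁅x⁆; x∈⁅y⁆⇒x≡y; ∣⁅x⁆∣≡1; p⊆q⇒∣p∣≤∣q∣
        ; x∈p∧x≢y⇒x∈p-y; x∈p⇒∣p-x∣<∣p∣; x∈p∩q⁺; x∈p∩q⁻; x∈p∪q⁺; x∈p∪q⁻ )
open import Data.Vec.Properties using (lookup∘tabulate; lookup⇒[]=; []=⇒lookup)
open import Data.List using ([]; _∷_)
open import Data.List.Membership.Propositional using () renaming (_∈_ to _∈ₗ_)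
open import Data.List.Relation.Unary.Any using (here; there)
open import Data.List.Relation.Unary.All using ([]; _∷_)
open import Data.List.Relation.Unary.All.Properties using (All¬⇒¬Any)
open import Data.List.Relation.Unary.AllPairs using ([]; _∷_)
open import Data.List.Relation.Unary.Unique.Propositional using (Unique)
open import Data.Product using (∃; _×_; _,_; proj₁)
open import Data.Sum using (_⊎_; inj₁; inj₂; [_,_]′)
open import Data.Empty using (⊥; ⊥-elim)
open import Function using (_∘_)
open import Level using (Level)
open import Relation.Nullary using (¬_; Dec; yes; no; ¬?; contradiction)
open import Relation.Nullary.Decidable using (_×-dec_; _→-dec_; decidable-stable)
open import Relation.Unary using (Pred; Decidable)
open import Relation.Binary.PropositionalEquality
  using (_≡_; _≢_; refl; sym; trans; cong; subst; ≢-sym)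

¬∀⟶∃∧¬ : ∀ {m} {p q : Level} {P : Pred (Fin m) p} {Q : Pred (Fin m) q} →
         Decidable P → Decidable Q → ¬ (∀ x → P x → Q x) → ∃ λ x → P x × ¬ Q x
¬∀⟶∃∧¬ {m} P? Q? ¬∀ with ¬∀⟶∃¬ m _ (λ x → P? x →-dec Q? x) ¬∀
... | x , ¬[Px→Qx] =
  x , decidable-stable (P? x) (λ ¬Px → ¬[Px→Qx] (λ Px → contradiction Px ¬Px)) ,
  λ Qx → ¬[Px→Qx] (λ _ → Qx)

module _ {m : ℕ} where

  ⊈⇒∃∉ : {p q : Subset m} → p ⊈ q → ∃ λ x → x ∈ p × x ∉ q
  ⊈⇒∃∉ {p} {q} p⊈q = ¬∀⟶∃∧¬ (_∈? p) (_∈? q) (λ p⊆q → p⊈q (p⊆q _))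

  in≢out : ∀ {p : Subset m} {x y} → x ∈ p → y ∉ p → x ≢ y
  in≢out x∈p y∉p refl = y∉p x∈p

  out≢in : ∀ {p : Subset m} {x y} → x ∉ p → y ∈ p → x ≢ y
  out≢in x∉p y∈p = ≢-sym (in≢out y∈p x∉p)

  Empty⇒∣p∣≡0 : {p : Subset m} → Empty p → ∣ p ∣ ≡ 0
  Empty⇒∣p∣≡0 empty = trans (cong ∣_∣ (Empty-unique empty)) (∣⊥∣≡0 m)

  x∈p⇒0<∣p∣ : ∀ {p : Subset m} {x} → x ∈ p → 0 < ∣ p ∣
  x∈p⇒0<∣p∣ {p} {x} x∈p = subst (_≤ ∣ p ∣) (∣⁅x⁆∣≡1 x) (p⊆q⇒∣p∣≤∣q∣ ⁅x⁆⊆p)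
    where
    ⁅x⁆⊆p : ⁅ x ⁆ ⊆ p
    ⁅x⁆⊆p y∈⁅x⁆ = subst (_∈ p) (sym (x∈⁅y⁆⇒x≡y x y∈⁅x⁆)) x∈p

  0<∣p∣⇒Nonempty : {p : Subset m} → 0 < ∣ p ∣ → Nonempty p
  0<∣p∣⇒Nonempty {p} 0<∣p∣ with nonempty? p
  ... | yes nonempty = nonempty
  ... | no empty = contradiction (Empty⇒∣p∣≡0 empty) (n>0⇒n≢0 0<∣p∣)

  x≢y⇒1<∣p∣ : ∀ {p : Subset m} {x y} → x ≢ y → x ∈ p → y ∈ p → 1 < ∣ p ∣
  x≢y⇒1<∣p∣ x≢y x∈p y∈p =
    ≤-trans (s≤s (x∈p⇒0<∣p∣ (x∈p∧x≢y⇒x∈p-y y∈p (≢-sym x≢y)))) (x∈p⇒∣p-x∣<∣p∣ x∈p)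

  all-equal⇒∣p∣≤1 : {p : Subset m} → (∀ {x y} → x ∈ p → y ∈ p → x ≡ y) → ∣ p ∣ ≤ 1
  all-equal⇒∣p∣≤1 {p} all-equal with nonempty? p
  ... | no empty = subst (_≤ 1) (sym (Empty⇒∣p∣≡0 empty)) z≤n
  ... | yes (x , x∈p) = subst (∣ p ∣ ≤_) (∣⁅x⁆∣≡1 x) (p⊆q⇒∣p∣≤∣q∣ p⊆⁅x⁆)
    where
    p⊆⁅x⁆ : p ⊆ ⁅ x ⁆
    p⊆⁅x⁆ y∈p = subst (_∈ ⁅ x ⁆) (all-equal x∈p y∈p) (x∈⁅x⁆ x)

module Adjacency {n : ℕ} (G : Graph n) where

  Adj? : ∀ u v → Dec (Adj G u v)
  Adj? u v = E G u v ≟ᵇ true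

  Adj-sym : ∀ {u v} → Adj G u v → Adj G v u
  Adj-sym {u} {v} u~v = trans (Graph.sym G v u) u~v

  Adj⇒≢ : ∀ {u v} → Adj G u v → u ≢ v
  Adj⇒≢ {u} u~u refl = contradiction (trans (sym u~u) (irrefl G u)) λ ()

  Adj⇒∈N : ∀ {v u} → Adj G v u → u ∈ N G v
  Adj⇒∈N {v} {u} v~u = lookup⇒[]= u (N G v) (trans (lookup∘tabulate (E G v) u) v~u)

  ∈N⇒Adj : ∀ {v u} → u ∈ N G v → Adj G v u
  ∈N⇒Adj {v} {u} u∈N = trans (sym (lookup∘tabulate (E G v) u)) ([]=⇒lookup u∈N)

  Adj⇒∈N[] : ∀ {v u} → Adj G v u → u ∈ N[_] G v
  Adj⇒∈N[] = x∈p∪q⁺ ∘ inj₁ ∘ Adj⇒∈N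

  v∈N[v] : ∀ v → v ∈ N[_] G v
  v∈N[v] v = x∈p∪q⁺ (inj₂ (x∈⁅x⁆ v))

  ∈N[]⇒Adj⊎≡ : ∀ {v u} → u ∈ N[_] G v → Adj G v u ⊎ u ≡ v
  ∈N[]⇒Adj⊎≡ {v} u∈N[v] = [ inj₁ ∘ ∈N⇒Adj , inj₂ ∘ x∈⁅y⁆⇒x≡y v ]′ (x∈p∪q⁻ (N G v) ⁅ v ⁆ u∈N[v])

  ∉N[]⇒≢ : ∀ {v u} → u ∉ N[_] G v → u ≢ v
  ∉N[]⇒≢ {v} u∉N[v] refl = u∉N[v] (v∈N[v] v)

module VectorDomination {n : ℕ} (G : Graph n) (d : Fin n → ℕ) (S : Subset n)
                        (dominated : ∀ v → v ∉ S → d v ≤ degIn G d S v) where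

  open Adjacency G

  AtMostOneNeighbourInS : Fin n → Set
  AtMostOneNeighbourInS x = ∀ {s t} → s ∈ S → t ∈ S → Adj G x s → Adj G x t → s ≡ t

  TwoNeighboursInS : Fin n → Set
  TwoNeighboursInS x = ∃ λ s → ∃ λ t → s ∈ S × t ∈ S × s ≢ t × Adj G x s × Adj G x t

  twoNeighboursInS? : ∀ x → Dec (TwoNeighboursInS x)
  twoNeighboursInS? x =
    any? λ s → any? λ t → s ∈? S ×-dec t ∈? S ×-dec ¬? (s ≟ t) ×-dec Adj? x s ×-dec Adj? x t

  ¬two⇒atMostOne : ∀ {x} → ¬ TwoNeighboursInS x → AtMostOneNeighbourInS x
  ¬two⇒atMostOne ¬two {s} {t} s∈S t∈S x~s x~t =
    decidable-stable (s ≟ t) λ s≢t → ¬two (s , t , s∈S , t∈S , s≢t , x~s , x~t)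

  ∈N∩S⁻ : ∀ {x s} → s ∈ N G x ∩ S → Adj G x s × s ∈ S
  ∈N∩S⁻ {x} s∈ with x∈p∩q⁻ (N G x) S s∈
  ... | s∈N , s∈S = ∈N⇒Adj s∈N , s∈S

  ∈N∩S⁺ : ∀ {x s} → Adj G x s → s ∈ S → s ∈ N G x ∩ S
  ∈N∩S⁺ x~s s∈S = x∈p∩q⁺ (Adj⇒∈N x~s , s∈S)

  degIn<2⇒atMostOne : ∀ {x} → degIn G d S x < 2 → AtMostOneNeighbourInS x
  degIn<2⇒atMostOne deg<2 {s} {t} s∈S t∈S x~s x~t =
    decidable-stable (s ≟ t) λ s≢t →
      <⇒≱ deg<2 (x≢y⇒1<∣p∣ s≢t (∈N∩S⁺ x~s s∈S) (∈N∩S⁺ x~t t∈S))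

  demand≤1 : ∀ {x} → x ∉ S → AtMostOneNeighbourInS x → d x ≤ 1
  demand≤1 {x} x∉S x-one = ≤-trans (dominated x x∉S) (all-equal⇒∣p∣≤1 all-equal)
    where
    all-equal : ∀ {s t} → s ∈ N G x ∩ S → t ∈ N G x ∩ S → s ≡ t
    all-equal s∈ t∈ with ∈N∩S⁻ s∈ | ∈N∩S⁻ t∈
    ... | x~s , s∈S | x~t , t∈S = x-one s∈S t∈S x~s x~t

  neighbourInS? : ∀ x → Dec (∃ λ s → s ∈ S × Adj G x s)
  neighbourInS? x = any? λ s → s ∈? S ×-dec Adj? x s

  neighbourInS : ∀ {x} → x ∉ S → 0 < d x → ∃ λ s → s ∈ S × Adj G x s
  neighbourInS {x} x∉S 0<dx with 0<∣p∣⇒Nonempty (≤-trans 0<dx (dominated x x∉S))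
  ... | s , s∈ with ∈N∩S⁻ s∈
  ...   | x~s , s∈S = s , s∈S , x~s

  neighbourInS-outside : ∀ {x a} → x ∉ S → 0 < d x → x ∉ N[_] G a →
                         ∃ λ s → s ∈ S × Adj G x s × s ≢ a
  neighbourInS-outside x∉S 0<dx x∉N[a] with neighbourInS x∉S 0<dx
  ... | s , s∈S , x~s = s , s∈S , x~s , λ { refl → x∉N[a] (Adj⇒∈N[] (Adj-sym x~s)) }

  otherNeighbour∉S : ∀ {v s x} → AtMostOneNeighbourInS v → s ∈ S → Adj G v s →
                     Adj G v x → x ≢ s → x ∉ S
  otherNeighbour∉S v-one s∈S v~s v~x x≢s x∈S = x≢s (v-one x∈S s∈S v~x v~s)

  ¬usedByType1 : ∀ {x} → x ∉ S → AtMostOneNeighbourInS x → ¬ UsedByType1 G d S x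
  ¬usedByType1 x∉S x-one
    (_ , (s₁ , s₂ , s₁∈S , s₂∈S , s₁≢s₂ , _ , refl , cons s₁~x (cons x~s₂ _) , _) , x∈P)
    with x∈P
  ... | here refl = x∉S s₁∈S
  ... | there (here refl) = s₁≢s₂ (x-one s₁∈S s₂∈S (Adj-sym s₁~x) x~s₂)
  ... | there (there (here refl)) = x∉S s₂∈S
  ... | there (there (there ()))

  onRealType1 : ∀ {s₁ v s₂} → s₁ ∈ S → s₂ ∈ S → s₁ ≢ s₂ → v ∉ S →
                Adj G v s₁ → Adj G v s₂ → OnRealPath G d S v
  onRealType1 {s₁} {v} {s₂} s₁∈S s₂∈S s₁≢s₂ v∉S v~s₁ v~s₂ =
    s₁ ∷ v ∷ s₂ ∷ [] ,
    inj₁ (s₁ , s₂ , s₁∈S , s₂∈S , s₁≢s₂ , v , refl ,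
          cons (Adj-sym v~s₁) (cons v~s₂ (one s₂)) , distinct) ,
    there (here refl)
    where
    distinct : Unique (s₁ ∷ v ∷ s₂ ∷ [])
    distinct = (in≢out s₁∈S v∉S ∷ s₁≢s₂ ∷ []) ∷ (out≢in v∉S s₂∈S ∷ []) ∷ [] ∷ []

  realType3 : ∀ {s₁ a b s₂} → s₁ ∈ S → s₂ ∈ S → s₁ ≢ s₂ → a ∉ S → b ∉ S →
              Adj G s₁ a → Adj G a b → Adj G b s₂ → AtMostOneNeighbourInS a →
              RealType3 G d S s₁ a b s₂
  realType3 {s₁} {a} {b} {s₂} s₁∈S s₂∈S s₁≢s₂ a∉S b∉S s₁~a a~b b~s₂ a-one =
    s₁∈S , s₂∈S ,
    (s₁≢s₂ , a , b , refl , (cons s₁~a (cons a~b (cons b~s₂ (one s₂))) , distinct) ,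
     demand≤1 a∉S a-one) ,
    ¬usedByType1 a∉S a-one ∘ proj₁
    where
    distinct : Unique (s₁ ∷ a ∷ b ∷ s₂ ∷ [])
    distinct = (in≢out s₁∈S a∉S ∷ in≢out s₁∈S b∉S ∷ s₁≢s₂ ∷ [])
             ∷ (Adj⇒≢ a~b ∷ out≢in a∉S s₂∈S ∷ [])
             ∷ (out≢in b∉S s₂∈S ∷ [])
             ∷ [] ∷ []

  onRealType3 : ∀ {s₁ a b s₂ x} → RealType3 G d S s₁ a b s₂ →
                x ∈ₗ s₁ ∷ a ∷ b ∷ s₂ ∷ [] → OnRealPath G d S x
  onRealType3 {s₁} {a} {b} {s₂} real x∈P =
    s₁ ∷ a ∷ b ∷ s₂ ∷ [] , inj₂ (inj₂ (s₁ , a , b , s₂ , refl , real)) , x∈P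

  onRealType2 : ∀ {s₁ a c b s₂ x} → s₁ ∈ S → s₂ ∈ S → a ∉ S → c ∉ S → b ∉ S →
                Adj G s₁ a → Adj G a c → Adj G c b → Adj G b s₂ → b ∉ N[_] G s₁ →
                d a ≡ 1 → d c ≡ 0 → AtMostOneNeighbourInS a →
                x ∈ₗ s₁ ∷ a ∷ c ∷ b ∷ s₂ ∷ [] → OnRealPath G d S x
  onRealType2 {s₁} {a} {c} {b} {s₂} s₁∈S s₂∈S a∉S c∉S b∉S s₁~a a~c c~b b~s₂ b∉N[s₁]
              da≡1 dc≡0 a-one x∈P =
    s₁ ∷ a ∷ c ∷ b ∷ s₂ ∷ [] ,
    inj₂ (inj₁ (s₁ , s₂ , s₁∈S , s₂∈S , a , c , b , refl ,
      (s₁≢s₂ , a , c , b , refl ,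
       (cons s₁~a (cons a~c (cons c~b (cons b~s₂ (one s₂)))) , distinct) ,
       dc≡0 , da≡1 , ¬a~s₂ , b∉N[s₁] ∘ Adj⇒∈N[] ∘ Adj-sym) ,
      ¬usedByType1 a∉S a-one ∘ proj₁)) ,
    x∈P
    where
    s₁≢s₂ : s₁ ≢ s₂
    s₁≢s₂ refl = b∉N[s₁] (Adj⇒∈N[] (Adj-sym b~s₂))

    ¬a~s₂ : ¬ Adj G a s₂
    ¬a~s₂ a~s₂ = s₁≢s₂ (a-one s₁∈S s₂∈S (Adj-sym s₁~a) a~s₂)

    a≢b : a ≢ b
    a≢b refl = b∉N[s₁] (Adj⇒∈N[] s₁~a)

    distinct : Unique (s₁ ∷ a ∷ c ∷ b ∷ s₂ ∷ [])
    distinct = (in≢out s₁∈S a∉S ∷ in≢out s₁∈S c∉S ∷ in≢out s₁∈S b∉S ∷ s₁≢s₂ ∷ [])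
             ∷ (Adj⇒≢ a~c ∷ a≢b ∷ out≢in a∉S s₂∈S ∷ [])
             ∷ (Adj⇒≢ c~b ∷ out≢in c∉S s₂∈S ∷ [])
             ∷ (out≢in b∉S s₂∈S ∷ [])
             ∷ [] ∷ []

  0<demandOfNeighbour : R1 G d → ∀ {v x} → d v ≡ 0 → Adj G v x → 0 < d x
  0<demandOfNeighbour r1 dv≡0 v~x = n≢0⇒n>0 (r1 _ _ v~x dv≡0)

  R4-escape : R4 G d → ∀ {v a} → d v ≡ 0 → a ≢ v →
              Adj G v a ⊎ (∃ λ w → Adj G v w × d w ≡ 1) →
              ∃ λ x → Adj G v x × x ∉ N[_] G a
  R4-escape r4 {v} {a} dv≡0 a≢v witness
    with ⊈⇒∃∉ (contradicts witness ∘ r4 v a dv≡0 a≢v)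
    where
    contradicts : Adj G v a ⊎ (∃ λ w → Adj G v w × d w ≡ 1) →
                  ¬ Adj G v a × (∀ w → Adj G v w → d w ≢ 1) → ⊥
    contradicts (inj₁ v~a) (¬v~a , _) = ¬v~a v~a
    contradicts (inj₂ (w , v~w , dw≡1)) (_ , no-1-neighbour) = no-1-neighbour w v~w dw≡1
  ... | x , x∈N , x∉N[a] = x , ∈N⇒Adj x∈N , x∉N[a]

  onRealPath₀-nextToS : R1 G d → R4 G d → ∀ {v s₁} → v ∉ S → d v ≡ 0 →
                        AtMostOneNeighbourInS v → s₁ ∈ S → Adj G v s₁ → OnRealPath G d S v
  onRealPath₀-nextToS r1 r4 v∉S dv≡0 v-one s₁∈S v~s₁
    with R4-escape r4 dv≡0 (in≢out s₁∈S v∉S) (inj₁ v~s₁)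
  ... | x , v~x , x∉N[s₁] =
    let s₂ , s₂∈S , x~s₂ , s₂≢s₁ =
          neighbourInS-outside x∉S (0<demandOfNeighbour r1 dv≡0 v~x) x∉N[s₁]
    in onRealType3 (realType3 s₁∈S s₂∈S (≢-sym s₂≢s₁) v∉S x∉S (Adj-sym v~s₁) v~x x~s₂ v-one)
                   (there (here refl))
    where
    x∉S : x ∉ S
    x∉S = otherNeighbour∉S v-one s₁∈S v~s₁ v~x (∉N[]⇒≢ x∉N[s₁])

  demandOneNeighbour : R1 G d → ∀ {v} → d v ≡ 0 → ¬ (∃ λ s → s ∈ S × Adj G v s) →
                       ¬ InA G d S v →
                       ∃ λ w → Adj G v w × w ∉ S × d w ≡ 1 × AtMostOneNeighbourInS w
  demandOneNeighbour r1 {v} dv≡0 ¬v~S ¬A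
    with ¬∀⟶∃∧¬ (Adj? v) (λ w → 2 ≤? degIn G d S w) (¬A ∘ (dv≡0 ,_))
  ... | w , v~w , ¬2≤deg =
    w , v~w , w∉S , ≤-antisym (demand≤1 w∉S w-one) (0<demandOfNeighbour r1 dv≡0 v~w) , w-one
    where
    w∉S : w ∉ S
    w∉S w∈S = ¬v~S (w , w∈S , v~w)

    w-one : AtMostOneNeighbourInS w
    w-one = degIn<2⇒atMostOne (≰⇒> ¬2≤deg)

  onRealPath₀-awayFromS : R1 G d → R4 G d → ∀ {v} → v ∉ S → d v ≡ 0 →
                          ¬ (∃ λ s → s ∈ S × Adj G v s) → ¬ InA G d S v → OnRealPath G d S v
  onRealPath₀-awayFromS r1 r4 v∉S dv≡0 ¬v~S ¬A with demandOneNeighbour r1 dv≡0 ¬v~S ¬A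
  ... | w , v~w , w∉S , dw≡1 , w-one with neighbourInS w∉S (≤-reflexive (sym dw≡1))
  ... | s₁ , s₁∈S , w~s₁ with R4-escape r4 dv≡0 (in≢out s₁∈S v∉S) (inj₂ (w , v~w , dw≡1))
  ... | x , v~x , x∉N[s₁] =
    let s₂ , s₂∈S , x~s₂ , _ =
          neighbourInS-outside x∉S (0<demandOfNeighbour r1 dv≡0 v~x) x∉N[s₁]
    in onRealType2 s₁∈S s₂∈S w∉S v∉S x∉S (Adj-sym w~s₁) (Adj-sym v~w) v~x x~s₂ x∉N[s₁]
                   dw≡1 dv≡0 w-one (there (there (here refl)))
    where
    x∉S : x ∉ S
    x∉S x∈S = ¬v~S (x , x∈S , v~x)

  module DemandOne {v s₁} (v∉S : v ∉ S) (dv≡1 : d v ≡ 1) (v-one : AtMostOneNeighbourInS v)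
                    (s₁∈S : s₁ ∈ S) (v~s₁ : Adj G v s₁) where

    Branch : Set
    Branch = ∃ λ x → Adj G v x × x ≢ s₁ × ∃ λ s₂ → s₂ ∈ S × Adj G x s₂ × s₂ ≢ s₁

    branch? : Dec Branch
    branch? = any? λ x → Adj? v x ×-dec ¬? (x ≟ s₁) ×-dec
                any? λ s₂ → s₂ ∈? S ×-dec Adj? x s₂ ×-dec ¬? (s₂ ≟ s₁)

    Detour : Set
    Detour = ∃ λ u → ∃ λ w → Adj G v u × u ≢ s₁ × Adj G u w × w ∉ N[_] G s₁ × 0 < d w

    detour? : Dec Detour
    detour? = any? λ u → any? λ w → Adj? v u ×-dec ¬? (u ≟ s₁) ×-dec Adj? u w ×-dec
                ¬? (w ∈? N[_] G s₁) ×-dec 0 <? d w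

    branch⇒onRealPath : Branch → OnRealPath G d S v
    branch⇒onRealPath (x , v~x , x≢s₁ , s₂ , s₂∈S , x~s₂ , s₂≢s₁) =
      onRealType3 (realType3 s₁∈S s₂∈S (≢-sym s₂≢s₁) v∉S x∉S (Adj-sym v~s₁) v~x x~s₂ v-one)
                  (there (here refl))
      where
      x∉S : x ∉ S
      x∉S = otherNeighbour∉S v-one s₁∈S v~s₁ v~x x≢s₁

    module _ (¬branch : ¬ Branch) where

      neighbour∉S : ∀ {u} → Adj G v u → u ≢ s₁ → u ∉ S
      neighbour∉S = otherNeighbour∉S v-one s₁∈S v~s₁

      onlyNeighbourInS : ∀ {u t} → Adj G v u → u ≢ s₁ → t ∈ S → Adj G u t → t ≡ s₁
      onlyNeighbourInS {u} {t} v~u u≢s₁ t∈S u~t =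
        decidable-stable (t ≟ s₁) λ t≢s₁ → ¬branch (u , v~u , u≢s₁ , t , t∈S , u~t , t≢s₁)

      neighbour-atMostOne : ∀ {u} → Adj G v u → u ≢ s₁ → AtMostOneNeighbourInS u
      neighbour-atMostOne v~u u≢s₁ s∈S t∈S u~s u~t =
        trans (onlyNeighbourInS v~u u≢s₁ s∈S u~s) (sym (onlyNeighbourInS v~u u≢s₁ t∈S u~t))

      neighbour~s₁ : ∀ {u} → Adj G v u → u ≢ s₁ → 0 < d u → Adj G u s₁
      neighbour~s₁ v~u u≢s₁ 0<du with neighbourInS (neighbour∉S v~u u≢s₁) 0<du
      ... | t , t∈S , u~t = subst (Adj G _) (onlyNeighbourInS v~u u≢s₁ t∈S u~t) u~t

      highDemandNeighbour∈N[s₁] : ∀ {x} → Adj G v x → 0 < d x → x ∈ N[_] G s₁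
      highDemandNeighbour∈N[s₁] {x} v~x 0<dx =
        decidable-stable (x ∈? N[_] G s₁) λ x∉N[s₁] →
          let x≢s₁ = ∉N[]⇒≢ x∉N[s₁]
              s₂ , s₂∈S , x~s₂ , s₂≢s₁ =
                neighbourInS-outside (neighbour∉S v~x x≢s₁) 0<dx x∉N[s₁]
          in ¬branch (x , v~x , x≢s₁ , s₂ , s₂∈S , x~s₂ , s₂≢s₁)

      R5-premise : ¬ Detour →
                   ∀ u → u ∈ N[_] G v → u ≢ s₁ → d u ≤ 1 × NhSubset G d u (N[_] G s₁)
      R5-premise ¬detour u u∈N[v] u≢s₁ with ∈N[]⇒Adj⊎≡ u∈N[v]
      ... | inj₂ refl = ≤-reflexive dv≡1 , Nh[v]⊆N[s₁]
        where
        Nh[v]⊆N[s₁] : NhSubset G d v (N[_] G s₁)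
        Nh[v]⊆N[s₁] w w∈N[v] 0<dw with ∈N[]⇒Adj⊎≡ w∈N[v]
        ... | inj₁ v~w = highDemandNeighbour∈N[s₁] v~w 0<dw
        ... | inj₂ refl = Adj⇒∈N[] (Adj-sym v~s₁)
      ... | inj₁ v~u = demand≤1 (neighbour∉S v~u u≢s₁) (neighbour-atMostOne v~u u≢s₁) , Nh[u]⊆N[s₁]
        where
        Nh[u]⊆N[s₁] : NhSubset G d u (N[_] G s₁)
        Nh[u]⊆N[s₁] w w∈N[u] 0<dw with ∈N[]⇒Adj⊎≡ w∈N[u]
        ... | inj₁ u~w = decidable-stable (w ∈? N[_] G s₁) λ w∉N[s₁] →
                           ¬detour (u , w , v~u , u≢s₁ , u~w , w∉N[s₁] , 0<dw)
        ... | inj₂ refl = highDemandNeighbour∈N[s₁] v~u 0<dw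

      detour : R5 G d → Detour
      detour r5 = decidable-stable detour? (r5 v s₁ dv≡1 v~s₁ ∘ R5-premise)

      detour⇒onRealPath : ¬ InL G d S v → Detour → OnRealPath G d S v
      detour⇒onRealPath ¬L (u , w , v~u , u≢s₁ , u~w , w∉N[s₁] , 0<dw) =
        byDemandOf-u (neighbourInS-outside w∉S 0<dw w∉N[s₁])
        where
        u∉S : u ∉ S
        u∉S = neighbour∉S v~u u≢s₁

        u-one : AtMostOneNeighbourInS u
        u-one = neighbour-atMostOne v~u u≢s₁

        w∉S : w ∉ S
        w∉S w∈S = ¬branch (u , v~u , u≢s₁ , w , w∈S , u~w , ∉N[]⇒≢ w∉N[s₁])

        byDemandOf-u : (∃ λ s₂ → s₂ ∈ S × Adj G w s₂ × s₂ ≢ s₁) → OnRealPath G d S v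
        byDemandOf-u (s₂ , s₂∈S , w~s₂ , s₂≢s₁) with n≤1⇒n≡0∨n≡1 (demand≤1 u∉S u-one)
        ... | inj₁ du≡0 =
          onRealType2 s₁∈S s₂∈S v∉S u∉S w∉S (Adj-sym v~s₁) v~u u~w w~s₂ w∉N[s₁]
                      dv≡1 du≡0 v-one (there (here refl))
        ... | inj₂ du≡1 = ⊥-elim (¬L (s₁ , u , w , s₂ , real , dv≡1 , v∉P , v~s₁ , v~u))
          where
          real : RealType3 G d S s₁ u w s₂
          real = realType3 s₁∈S s₂∈S (≢-sym s₂≢s₁) u∉S w∉S
                   (Adj-sym (neighbour~s₁ v~u u≢s₁ (≤-reflexive (sym du≡1)))) u~w w~s₂ u-one

          v∉P : ¬ v ∈ₗ s₁ ∷ u ∷ w ∷ s₂ ∷ []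
          v∉P = All¬⇒¬Any ( out≢in v∉S s₁∈S ∷ Adj⇒≢ v~u
                          ∷ in≢out (Adj⇒∈N[] (Adj-sym v~s₁)) w∉N[s₁] ∷ out≢in v∉S s₂∈S ∷ [])

    onRealPath₁ : R5 G d → ¬ InL G d S v → OnRealPath G d S v
    onRealPath₁ r5 ¬L with branch?
    ... | yes branch = branch⇒onRealPath branch
    ... | no ¬branch = detour⇒onRealPath ¬branch ¬L (detour ¬branch r5)

  onRealPath : R1 G d → R4 G d → R5 G d →
               ∀ v → v ∉ S → ¬ InA G d S v → ¬ InL G d S v → OnRealPath G d S v
  onRealPath r1 r4 r5 v v∉S ¬A ¬L with twoNeighboursInS? v
  ... | yes (s₁ , s₂ , s₁∈S , s₂∈S , s₁≢s₂ , v~s₁ , v~s₂) =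
    onRealType1 s₁∈S s₂∈S s₁≢s₂ v∉S v~s₁ v~s₂
  ... | no ¬two with ¬two⇒atMostOne ¬two
  ... | v-one with n≤1⇒n≡0∨n≡1 (demand≤1 v∉S v-one) | neighbourInS? v
  ... | inj₁ dv≡0 | yes (s₁ , s₁∈S , v~s₁) = onRealPath₀-nextToS r1 r4 v∉S dv≡0 v-one s₁∈S v~s₁
  ... | inj₁ dv≡0 | no ¬v~S = onRealPath₀-awayFromS r1 r4 v∉S dv≡0 ¬v~S ¬A
  ... | inj₂ dv≡1 | yes (s₁ , s₁∈S , v~s₁) =
    DemandOne.onRealPath₁ v∉S dv≡1 v-one s₁∈S v~s₁ r5 ¬L
  ... | inj₂ dv≡1 | no ¬v~S = contradiction (neighbourInS v∉S (≤-reflexive (sym dv≡1))) ¬v~S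

lemma1 : ∀ {n} (G : Graph n) → Planar G → (d : Fin n → ℕ) (k : ℕ) →
         Reduced G d k → (S : Subset n) → Solution G d k S →
         ∀ v → v ∉ S → ¬ InA G d S v → ¬ InL G d S v → OnRealPath G d S v
lemma1 G _ d _ (r1 , _ , _ , r4 , r5) S (_ , dominated) =
  VectorDomination.onRealPath G d S dominated r1 r4 r5
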